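{- Let $P=\{p_1<p_2<\cdots<p_k\}\subseteq[n]$ and let $N$ be the set of the $k+1$ smallest positive integers not in $P$. Standardize the set $P\cup N$ to $[2k+1]$ via the unique order-preserving bijection $P\cup N\to[2k+1]$, and let $P'$ be the image of $P$. Then the number of admissible orderings of $P$ (with respect to $S_n$) equals the number of admissible orderings of $P'$ (with respect to $S_{2k+1}$).
   Context: For a word $\pi=\pi_1\cdots\pi_m$ of distinct integers, $\mathrm{Pin}(\pi)=\{\pi_i:1<i<m,\ \pi_{i-1}<\pi_i>\pi_{i+1}\}$. For a permutation $\pi$ of a set containing $S$ and an ordering $\omega$ of $S$, $\mathrm{ord}(\pi)=\omega$ means the elements of $S$ appear in $\pi$ in the same relative order as in $\omega$. An admissible ordering of $P\subseteq[n]$ with respect to $S_n$ is an ordering $\omega$ of $P$ such that there exists $\pi\in S_n$ with $\mathrm{Pin}(\pi)=P$ and $\mathrm{ord}(\pi)=\omega$ (if no such $\pi$ exists for any ordering, the number of admissible orderings is $0$). -}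

module Defs where

open import Data.Nat using (ℕ; zero; suc; _+_; _<_; _≤_; _<?_; _≤?_)
import Data.Nat as ℕ
open import Data.List using (List; []; _∷_; map; filter; take; length; upTo; _++_)
open import Data.List.Membership.Propositional using (_∈_)
open import Data.List.Membership.DecPropositional ℕ._≟_ using (_∈?_; _∉?_)
open import Data.List.Relation.Unary.All using (All)
open import Data.List.Relation.Unary.Unique.Propositional using (Unique)
open import Data.List.Relation.Unary.AllPairs using (AllPairs)
open import Data.List.Relation.Binary.Permutation.Propositional using (_↭_)
open import Data.Product using (Σ; _×_; ∃; ∃-syntax)
open import Function.Bundles using (_⇔_)
open import Relation.Nullary using (yes; no)
open import Data.Bool using (Bool; if_then_else_; _∧_)
open import Data.Nat using (_<ᵇ_)

[1‥_] : ℕ → List ℕ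
[1‥ n ] = map suc (upTo n)

isPeak : ℕ → ℕ → ℕ → Bool
isPeak a b c = (a <ᵇ b) ∧ (c <ᵇ b)

Pin : List ℕ → List ℕ
Pin (a ∷ rest@(b ∷ c ∷ _)) = (if isPeak a b c then b ∷ Pin rest else Pin rest)
Pin _ = []

ord : List ℕ → List ℕ → List ℕ
ord P π = filter (_∈? P) π

Admissible : ℕ → List ℕ → List ℕ → Set
Admissible n P ω =
  (ω ↭ P) ×
  ∃[ π ] ((π ↭ [1‥ n ]) × (∀ x → (x ∈ Pin π) ⇔ (x ∈ P)) × (ord P π ≡′ ω))
  where open import Relation.Binary.PropositionalEquality renaming (_≡_ to _≡′_)

NumAdmissible : ℕ → List ℕ → ℕ → Set
NumAdmissible n P c =
  ∃[ L ] (Unique L × (∀ ω → (ω ∈ L) ⇔ Admissible n P ω) × (length L ≡′ c))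
  where open import Relation.Binary.PropositionalEquality renaming (_≡_ to _≡′_)

IsSubsetOf[n] : ℕ → List ℕ → Set
IsSubsetOf[n] n P = AllPairs _<_ P × All (λ p → 1 ≤ p × p ≤ n) P

-- N: the k+1 smallest positive integers not in P (k = |P|); they all lie in [2k+1]
Nset : List ℕ → List ℕ
Nset P = take (suc (length P)) (filter (_∉? P) [1‥ suc (length P + length P) ])

countLE : ℕ → List ℕ → ℕ
countLE x L = length (filter (_≤? x) L)

-- P': image of P under the order-preserving bijection P ∪ N → [2k+1]
-- (P and N are disjoint, so the rank of p in P ∪ N is #{y ∈ P ++ N | y ≤ p})
standardize : List ℕ → List ℕ
standardize P = map (λ p → countLE p (P ++ Nset P)) P

-- Read a permutation with pinnacle set P only at its pinnacles, in the order ω in which it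
-- visits them, and at k + 1 suitably chosen valleys: this gives a zigzag
-- v < q₁ > w₁ < q₂ > ⋯ < qₖ > wₖ of distinct positive numbers, the valleys outside P.
-- Conversely, a zigzag whose valleys are exactly N, followed by the remaining numbers in
-- increasing order (all larger than N), is a permutation with pinnacle set P visiting it in
-- the order ω. Lowering valleys keeps the zigzag, and N consists of the k + 1 smallest
-- positive numbers outside P, so the valleys can always be moved into N. Hence ω is
-- admissible iff it carries a zigzag with valley set N, which depends only on the relative
-- order of P ∪ N and is therefore preserved by standardization.

module Submission where

open import Defs
import Data.Nat as ℕ
open import Data.Bool using (true; false)
open import Data.List
  using (List; []; _∷_; _++_; length; map; filter; upTo; take; concatMap; deduplicate)
open import Data.List.Membership.Propositional using (_∈_; _∉_; find; lose)
open import Data.List.Membership.Propositional.Properties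
  using (∈-map⁺; ∈-map⁻; ∈-upTo⁺; ∈-upTo⁻; ∈-∃++; ∈-++⁺ˡ; ∈-++⁺ʳ; ∈-++⁻; ∈-filter⁺; ∈-filter⁻;
         ∈-concatMap⁺; ∈-concatMap⁻; ∈-deduplicate⁺; ∈-deduplicate⁻)
open import Data.List.Membership.DecPropositional ℕ._≟_ using (_∈?_; _∉?_)
open import Data.List.Properties
  using (length-map; length-upTo; length-++; length-take; length-filter; filter-accept; filter-reject;
         filter-none; filter-some; filter-++; map-++; ++-assoc; ∷-injectiveˡ; ∷-injectiveʳ; ≡-dec)
open import Data.List.Relation.Binary.Permutation.Propositional
  using (_↭_; ↭-refl; ↭-sym; ↭-trans; ↭-prep; ↭-swap; ↭⇒↭ₛ; module PermutationReasoning)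
open import Data.List.Relation.Binary.Permutation.Propositional.Properties
  using (shift; shifts; ↭-length; ++-identityʳ; ↭-empty-inv; drop-mid; ∈-resp-↭)
  renaming (map⁺ to ↭-map⁺; ++⁺ to ↭-++⁺; ++⁺ʳ to ↭-++⁺ʳ; ++-comm to ↭-++-comm)
import Data.List.Relation.Binary.Permutation.Setoid.Properties as Permₛ
open import Data.List.Relation.Binary.Subset.Propositional using (_⊆_)
open import Data.List.Relation.Binary.Subset.Propositional.Properties using (⊆-respʳ-↭; ⊆∷∧∉⇒⊆; ∈-∷⁺ʳ)
import Data.List.Relation.Binary.Subset.Propositional.Properties as Subsetₚ
open import Data.List.Relation.Binary.Sublist.Propositional
  using ([]; _∷_; _∷ʳ_; lookup) renaming (_⊆_ to _⊑_; ⊆-refl to ⊑-refl)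
import Data.List.Relation.Binary.Sublist.Propositional.Properties as Sublistₚ
open import Data.List.Relation.Binary.Pointwise as Pointwise using (Pointwise; []; _∷_)
open import Data.List.Relation.Unary.All as All using (All; []; _∷_)
import Data.List.Relation.Unary.All.Properties as All
open import Data.List.Relation.Unary.All.Properties using (¬Any⇒All¬)
open import Data.List.Relation.Unary.AllPairs using (AllPairs; []; _∷_)
import Data.List.Relation.Unary.AllPairs as AllPairs
import Data.List.Relation.Unary.AllPairs.Properties as AllPairsₚ
open import Data.List.Relation.Unary.Any as Any using (here; there)
open import Data.List.Relation.Unary.Unique.Propositional using (Unique)
import Data.List.Relation.Unary.Unique.Propositional.Properties as Uniqueₚ
import Data.List.Relation.Unary.Unique.DecPropositional.Properties as UniqueDecₚ
open import Data.Nat using (ℕ; suc; _+_; _≤_; _<_; _<ᵇ_; _≤?_; _<?_; z≤n; s≤s; z<s)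
open import Data.Nat.Properties
open import Data.Nat.Induction using (<-wellFounded)
open import Induction.WellFounded using (Acc; acc)
open import Data.Product using (∃-syntax; _×_; _,_; proj₁; proj₂)
open import Data.Sum using (inj₁; inj₂)
open import Function using (_∘_; id)
open import Function.Bundles using (_⇔_; mk⇔; Equivalence)
open import Relation.Binary.PropositionalEquality
open import Relation.Binary.Definitions using (tri<; tri≈; tri>)
open import Relation.Nullary using (¬_; contradiction; Dec; yes; no)
open import Relation.Nullary.Decidable using (_×-dec_; map′)
open import Relation.Nullary.Reflects using (ofʸ; ofⁿ)
open import Relation.Unary using (Decidable)

open Equivalence using (to; from)

Unique-resp-↭ : ∀ {A : Set} {xs ys : List A} → xs ↭ ys → Unique xs → Unique ys
Unique-resp-↭ {A} p = Permₛ.Unique-resp-↭ (setoid A) (↭⇒↭ₛ p)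

Unique-⊆⇒↭++ : ∀ {A : Set} {xs ys : List A} → Unique xs → xs ⊆ ys → ∃[ zs ] (ys ↭ xs ++ zs)
Unique-⊆⇒↭++ {xs = []} {ys} _ _ = ys , ↭-refl
Unique-⊆⇒↭++ {xs = x ∷ xs} u x∷xs⊆ys
  with as , bs , refl ← ∈-∃++ (x∷xs⊆ys (here refl))
  with zs , p ← Unique-⊆⇒↭++ (AllPairs.tail u)
                  (⊆∷∧∉⇒⊆ (⊆-respʳ-↭ (shift x as bs) (x∷xs⊆ys ∘ there)) (Uniqueₚ.Unique[x∷xs]⇒x∉xs u))
  = zs , ↭-trans (shift x as bs) (↭-prep x p)

Unique-⊆⇒length≤ : ∀ {A : Set} {xs ys : List A} → Unique xs → xs ⊆ ys → length xs ≤ length ys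
Unique-⊆⇒length≤ {xs = xs} u xs⊆ys with zs , p ← Unique-⊆⇒↭++ u xs⊆ys =
  subst (length xs ≤_) (sym (trans (↭-length p) (length-++ xs))) (m≤m+n (length xs) (length zs))

Unique-⊆-length⇒↭ : ∀ {A : Set} {xs ys : List A} →
  Unique xs → xs ⊆ ys → length ys ≤ length xs → ys ↭ xs
Unique-⊆-length⇒↭ {xs = xs} u xs⊆ys len with Unique-⊆⇒↭++ u xs⊆ys
... | [] , p = ↭-trans p (++-identityʳ xs)
... | z ∷ zs , p = contradiction len (<⇒≱ (subst (length xs <_)
        (sym (trans (↭-length p) (length-++ xs))) (m<m+n (length xs) z<s)))

Unique-map⁺ : ∀ {A B : Set} {f : A → B} {xs} →
  (∀ {x y} → x ∈ xs → y ∈ xs → f x ≡ f y → x ≡ y) → Unique xs → Unique (map f xs)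
Unique-map⁺ {xs = []}     _   []         = []
Unique-map⁺ {xs = x ∷ xs} inj (x∉xs ∷ u) =
  All.map⁺ (All.tabulate λ y∈ fx≡fy → All.lookup x∉xs y∈ (inj (here refl) (there y∈) fx≡fy))
  ∷ Unique-map⁺ (λ x∈ y∈ → inj (there x∈) (there y∈)) u

map-injectiveOn : ∀ {A B : Set} {f : A → B} {L} → (∀ {x y} → x ∈ L → y ∈ L → f x ≡ f y → x ≡ y) →
  ∀ {xs ys} → xs ⊆ L → ys ⊆ L → map f xs ≡ map f ys → xs ≡ ys
map-injectiveOn inj {[]}     {[]}     _     _     _  = refl
map-injectiveOn inj {x ∷ xs} {y ∷ ys} xs⊆L ys⊆L eq =
  cong₂ _∷_ (inj (xs⊆L (here refl)) (ys⊆L (here refl)) (∷-injectiveˡ eq))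
            (map-injectiveOn inj (xs⊆L ∘ there) (ys⊆L ∘ there) (∷-injectiveʳ eq))

Unique-replace : ∀ {A : Set} {u a : A} as bs →
  Unique (as ++ u ∷ bs) → a ∉ as ++ u ∷ bs → Unique (as ++ a ∷ bs)
Unique-replace {u = u} {a} as bs uniq a∉ =
  Unique-resp-↭ (↭-sym (shift a as bs))
    (¬Any⇒All¬ _ (a∉ ∘ ∈-resp-↭ (↭-sym (shift u as bs)) ∘ there)
     ∷ AllPairs.tail (Unique-resp-↭ (shift u as bs) uniq))

take-< : ∀ j {xs a u} → AllPairs _<_ xs → a ∈ take j xs → u ∈ xs → u ∉ take j xs → a < u
take-< (suc j) {x ∷ xs} (x< ∷ _)   (here refl) (there u∈) _    = All.lookup x< u∈
take-< (suc j) {x ∷ xs} _          _           (here refl) u∉ = contradiction (here refl) u∉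
take-< (suc j) {x ∷ xs} (_ ∷ inc)  (there a∈)  (there u∈) u∉ = take-< j inc a∈ u∈ (u∉ ∘ there)

filter-⊑ : ∀ {A : Set} {P : A → Set} (P? : Decidable P) {xs ys} → Unique ys → xs ⊑ ys →
  (∀ {y} → y ∈ ys → P y ⇔ y ∈ xs) → filter P? ys ≡ xs
filter-⊑ P? [] [] _ = refl
filter-⊑ P? (y∉ys ∷ u) (y ∷ʳ τ) P⇔ =
  trans (filter-reject P? (λ Py → All.lookup y∉ys (lookup τ (to (P⇔ (here refl)) Py)) refl))
        (filter-⊑ P? u τ (P⇔ ∘ there))
filter-⊑ P? (y∉ys ∷ u) (refl ∷ τ) P⇔ =
  trans (filter-accept P? (from (P⇔ (here refl)) (here refl)))
        (cong (_ ∷_) (filter-⊑ P? u τ λ z∈ys → mk⇔ (drop-y z∈ys ∘ to (P⇔ (there z∈ys)))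
                                                   (from (P⇔ (there z∈ys)) ∘ there)))
  where
  drop-y : ∀ {z zs} → z ∈ _ → z ∈ _ ∷ zs → z ∈ zs
  drop-y z∈ys (here refl) = contradiction refl (All.lookup y∉ys z∈ys)
  drop-y _    (there z∈)  = z∈

∈-[1‥]⁺ : ∀ {n x} → 1 ≤ x → x ≤ n → x ∈ [1‥ n ]
∈-[1‥]⁺ {x = suc y} (s≤s _) y<n = ∈-map⁺ suc (∈-upTo⁺ y<n)

∈-[1‥]⁻ : ∀ {n x} → x ∈ [1‥ n ] → 1 ≤ x × x ≤ n
∈-[1‥]⁻ x∈ with y , y∈ , refl ← ∈-map⁻ suc x∈ = s≤s z≤n , ∈-upTo⁻ y∈

[1‥]-increasing : ∀ n → AllPairs _<_ [1‥ n ]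
[1‥]-increasing n = AllPairsₚ.map⁺ (AllPairsₚ.applyUpTo⁺₁ id n (λ i<j _ → s≤s i<j))

Unique-[1‥] : ∀ n → Unique [1‥ n ]
Unique-[1‥] n = AllPairs.map <⇒≢ ([1‥]-increasing n)

length-[1‥] : ∀ n → length [1‥ n ] ≡ n
length-[1‥] n = trans (length-map suc (upTo n)) (length-upTo n)

<ᵇ-true : ∀ {m n} → m < n → (m <ᵇ n) ≡ true
<ᵇ-true {m} {n} m<n with m <ᵇ n | <ᵇ-reflects-< m n
... | true  | _        = refl
... | false | ofⁿ m≮n = contradiction m<n m≮n

Pin-peak : ∀ {a b c} l → a < b → c < b → Pin (a ∷ b ∷ c ∷ l) ≡ b ∷ Pin (b ∷ c ∷ l)
Pin-peak l a<b c<b rewrite <ᵇ-true a<b | <ᵇ-true c<b = refl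

Pin-nonpeak : ∀ {a b c} l → ¬ (a < b × c < b) → Pin (a ∷ b ∷ c ∷ l) ≡ Pin (b ∷ c ∷ l)
Pin-nonpeak {a} {b} {c} l ¬peak with a <ᵇ b | <ᵇ-reflects-< a b | c <ᵇ b | <ᵇ-reflects-< c b
... | true  | ofʸ a<b | true  | ofʸ c<b = contradiction (a<b , c<b) ¬peak
... | true  | _       | false | _       = refl
... | false | _       | _     | _       = refl

Pin-descent : ∀ {a b} l → b < a → Pin (a ∷ b ∷ l) ≡ Pin (b ∷ l)
Pin-descent []      _   = refl
Pin-descent (c ∷ l) b<a = Pin-nonpeak l (λ (a<b , _) → <-asym a<b b<a)

Pin-increasing : ∀ {xs} → AllPairs _<_ xs → Pin xs ≡ []
Pin-increasing []           = refl
Pin-increasing (_ ∷ [])     = refl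
Pin-increasing (_ ∷ _ ∷ []) = refl
Pin-increasing {_ ∷ _ ∷ _ ∷ l} (_ ∷ inc@((b<c ∷ _) ∷ _)) =
  trans (Pin-nonpeak l (λ (_ , c<b) → <-asym b<c c<b)) (Pin-increasing inc)

Pin-⊑ : ∀ a l → Pin (a ∷ l) ⊑ l
Pin-⊑ a []          = []
Pin-⊑ a (b ∷ [])    = b ∷ʳ []
Pin-⊑ a (b ∷ l@(c ∷ _)) with isPeak a b c | Pin-⊑ b l
... | true  | τ = refl ∷ τ
... | false | τ = b ∷ʳ τ

Pin-⊆ : ∀ a l → Pin (a ∷ l) ⊆ l
Pin-⊆ a l = lookup (Pin-⊑ a l)

ord-≡-Pin : ∀ {Q a l} → Unique (a ∷ l) → (∀ x → x ∈ Pin (a ∷ l) ⇔ x ∈ Q) →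
  ord Q (a ∷ l) ≡ Pin (a ∷ l)
ord-≡-Pin {Q} {a} {l} u pins =
  filter-⊑ (_∈? Q) u (a ∷ʳ Pin-⊑ a l) (λ {x} _ → mk⇔ (from (pins x)) (to (pins x)))

-- Zigzags

-- Zigzag v (w₁ ∷ … ∷ wₖ) (q₁ ∷ … ∷ qₖ) states v < q₁ > w₁ < q₂ > w₂ ⋯ < qₖ > wₖ.
data Zigzag : ℕ → List ℕ → List ℕ → Set where
  end  : ∀ {v} → Zigzag v [] []
  peak : ∀ {v w vs q qs} → v < q → w < q → Zigzag w vs qs → Zigzag v (w ∷ vs) (q ∷ qs)

weave : List ℕ → List ℕ → List ℕ → List ℕ
weave (w ∷ vs) (q ∷ qs) t = q ∷ w ∷ weave vs qs t
weave _        _        t = t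

Zigzag-length : ∀ {v vs qs} → Zigzag v vs qs → length vs ≡ length qs
Zigzag-length end            = refl
Zigzag-length (peak _ _ zig) = cong suc (Zigzag-length zig)

Zigzag-lower : ∀ {v v′ vs vs′ qs} → Pointwise _≤_ (v′ ∷ vs′) (v ∷ vs) →
  Zigzag v vs qs → Zigzag v′ vs′ qs
Zigzag-lower (_ ∷ []) end = end
Zigzag-lower (v′≤v ∷ ws≤@(w′≤w ∷ _)) (peak v<q w<q zig) =
  peak (≤-<-trans v′≤v v<q) (≤-<-trans w′≤w w<q) (Zigzag-lower ws≤ zig)

Zigzag-map : ∀ {L v vs qs} (f : ℕ → ℕ) → (∀ {x y} → y ∈ L → x < y → f x < f y) → qs ⊆ L →
  Zigzag v vs qs → Zigzag (f v) (map f vs) (map f qs)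
Zigzag-map f mono qs⊆L end = end
Zigzag-map f mono qs⊆L (peak v<q w<q zig) =
  peak (mono (qs⊆L (here refl)) v<q) (mono (qs⊆L (here refl)) w<q)
       (Zigzag-map f mono (qs⊆L ∘ there) zig)

Zigzag-unmap : ∀ {v} vs qs (f : ℕ → ℕ) → (∀ {x y} → f x < f y → x < y) →
  Zigzag (f v) (map f vs) (map f qs) → Zigzag v vs qs
Zigzag-unmap []       []       f reflects end                = end
Zigzag-unmap (w ∷ vs) (q ∷ qs) f reflects (peak v<q w<q zig) =
  peak (reflects v<q) (reflects w<q) (Zigzag-unmap vs qs f reflects zig)

Zigzag-bounded : ∀ {n v vs qs x} → Zigzag v vs qs → All (_≤ n) qs → x ∈ qs → All (_≤ n) (v ∷ vs)
Zigzag-bounded (peak v<q w<q end) (q≤n ∷ []) _ =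
  <⇒≤ (<-≤-trans v<q q≤n) ∷ <⇒≤ (<-≤-trans w<q q≤n) ∷ []
Zigzag-bounded (peak v<q _ zig@(peak _ _ _)) (q≤n ∷ qs≤n) _ =
  <⇒≤ (<-≤-trans v<q q≤n) ∷ Zigzag-bounded zig qs≤n (here refl)

weave-↭ : ∀ {v vs qs} t → Zigzag v vs qs → weave vs qs t ↭ vs ++ qs ++ t
weave-↭ t end = ↭-refl
weave-↭ {vs = w ∷ vs} {q ∷ qs} t (peak _ _ zig) =
  ↭-trans (↭-swap q w (weave-↭ t zig)) (↭-prep w (↭-sym (shift q vs (qs ++ t))))

Pin-weave : ∀ {v vs qs t} → Zigzag v vs qs → AllPairs _<_ t → All (λ r → All (_< r) (v ∷ vs)) t →
  Pin (v ∷ weave vs qs t) ≡ qs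
Pin-weave end inc above = Pin-increasing (All.map All.head above ∷ inc)
Pin-weave {vs = w ∷ vs} {q ∷ qs} {t} (peak v<q w<q zig) inc above = begin
  Pin (_ ∷ q ∷ w ∷ weave vs qs t) ≡⟨ Pin-peak (weave vs qs t) v<q w<q ⟩
  q ∷ Pin (q ∷ w ∷ weave vs qs t) ≡⟨ cong (q ∷_) (Pin-descent (weave vs qs t) w<q) ⟩
  q ∷ Pin (w ∷ weave vs qs t)     ≡⟨ cong (q ∷_) (Pin-weave zig inc (All.map All.tail above)) ⟩
  q ∷ qs                          ∎
  where open ≡-Reasoning

ord-weave : ∀ {Q v vs qs t} → Zigzag v vs qs →
  All (_∉ Q) (v ∷ vs) → All (_∈ Q) qs → All (_∉ Q) t → ord Q (v ∷ weave vs qs t) ≡ qs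
ord-weave {Q} end (v∉Q ∷ []) [] t∉Q =
  trans (filter-reject (_∈? Q) v∉Q) (filter-none (_∈? Q) t∉Q)
ord-weave {Q} (peak _ _ zig) (v∉Q ∷ V∉Q) (q∈Q ∷ qs∈Q) t∉Q =
  trans (filter-reject (_∈? Q) v∉Q)
        (trans (filter-accept (_∈? Q) q∈Q) (cong (_ ∷_) (ord-weave zig V∉Q qs∈Q t∉Q)))

-- The skeleton of a permutation

-- valley≤ and valley≤next are only there to let `skeleton` extend a skeleton to the left.
record Skeleton (a : ℕ) (l : List ℕ) : Set where
  field
    valley        : ℕ
    valleys       : List ℕ
    zigzag        : Zigzag valley valleys (Pin (a ∷ l))
    valley∈       : valley ∈ a ∷ l
    valleys⊆      : valleys ⊆ l
    unique        : Unique (valley ∷ valleys)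
    ∉Pin          : All (_∉ Pin (a ∷ l)) (valley ∷ valleys)
    valley≤       : valley ≤ a
    valley≤next   : All (valley ≤_) (take 1 l)

  valleys⊆word : valley ∷ valleys ⊆ a ∷ l
  valleys⊆word = ∈-∷⁺ʳ valley∈ (there ∘ valleys⊆)

Skeleton-extend : ∀ {a b l} → Unique (a ∷ b ∷ l) → Pin (a ∷ b ∷ l) ≡ Pin (b ∷ l) →
  Skeleton b l → Skeleton a (b ∷ l)
Skeleton-extend {a} {b} {l} u pin≡ S with a ≤? Skeleton.valley S
... | yes a≤v = record
  { valley      = a
  ; valleys     = S.valleys
  ; zigzag      = subst (Zigzag a S.valleys) (sym pin≡)
                    (Zigzag-lower (a≤v ∷ Pointwise.refl ≤-refl) S.zigzag)
  ; valley∈     = here refl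
  ; valleys⊆    = there ∘ S.valleys⊆
  ; unique      = ¬Any⇒All¬ S.valleys (a∉b∷l ∘ there ∘ S.valleys⊆) ∷ AllPairs.tail S.unique
  ; ∉Pin        = subst (λ p → All (_∉ p) (a ∷ S.valleys)) (sym pin≡)
                    ((a∉b∷l ∘ Pin-⊆ a (b ∷ l) ∘ subst (a ∈_) (sym pin≡)) ∷ All.tail S.∉Pin)
  ; valley≤     = ≤-refl
  ; valley≤next = ≤-trans a≤v S.valley≤ ∷ []
  }
  where
  module S = Skeleton S
  a∉b∷l = Uniqueₚ.Unique[x∷xs]⇒x∉xs u
... | no a≰v = record
  { valley      = S.valley
  ; valleys     = S.valleys
  ; zigzag      = subst (Zigzag S.valley S.valleys) (sym pin≡) S.zigzag
  ; valley∈     = there S.valley∈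
  ; valleys⊆    = there ∘ S.valleys⊆
  ; unique      = S.unique
  ; ∉Pin        = subst (λ p → All (_∉ p) (S.valley ∷ S.valleys)) (sym pin≡) S.∉Pin
  ; valley≤     = <⇒≤ (≰⇒> a≰v)
  ; valley≤next = S.valley≤ ∷ []
  }
  where module S = Skeleton S

Skeleton-extend-peak : ∀ {a b c l} → Unique (a ∷ b ∷ c ∷ l) → a < b → c < b →
  Skeleton b (c ∷ l) → Skeleton a (b ∷ c ∷ l)
Skeleton-extend-peak {a} {b} {c} {l} u a<b c<b S = record
  { valley      = a
  ; valleys     = S.valley ∷ S.valleys
  ; zigzag      = subst (Zigzag a (S.valley ∷ S.valleys)) (sym pin≡) (peak a<b v<b S.zigzag)
  ; valley∈     = here refl
  ; valleys⊆    = S.valleys⊆word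
  ; unique      = ¬Any⇒All¬ _ (a∉b∷c∷l ∘ S.valleys⊆word) ∷ S.unique
  ; ∉Pin        = subst (λ p → All (_∉ p) (a ∷ S.valley ∷ S.valleys)) (sym pin≡)
                    ( ∉-∷ (<⇒≢ a<b) (a∉b∷c∷l ∘ there ∘ Pin-⊆ b (c ∷ l))
                    ∷ ∉-∷ (<⇒≢ v<b) (All.head S.∉Pin)
                    ∷ All.zipWith (λ (w∈ , w∉Pin) → ∉-∷ (λ { refl → b∉c∷l w∈ }) w∉Pin)
                                  (All.tabulate S.valleys⊆ , All.tail S.∉Pin))
  ; valley≤     = ≤-refl
  ; valley≤next = <⇒≤ a<b ∷ []
  }
  where
  module S = Skeleton S
  pin≡ = Pin-peak l a<b c<b
  v<b : S.valley < b
  v<b with v≤c ∷ [] ← S.valley≤next = ≤-<-trans v≤c c<b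
  a∉b∷c∷l = Uniqueₚ.Unique[x∷xs]⇒x∉xs u
  b∉c∷l = Uniqueₚ.Unique[x∷xs]⇒x∉xs (AllPairs.tail u)
  ∉-∷ : ∀ {x y ys} → x ≢ y → x ∉ ys → x ∉ y ∷ ys
  ∉-∷ x≢y _    (here x≡y) = x≢y x≡y
  ∉-∷ _   x∉ys (there x∈) = x∉ys x∈

skeleton : ∀ a l → Unique (a ∷ l) → Skeleton a l
skeleton a [] _ = record
  { valley = a ; valleys = [] ; zigzag = end ; valley∈ = here refl ; valleys⊆ = λ ()
  ; unique = [] ∷ [] ; ∉Pin = (λ ()) ∷ [] ; valley≤ = ≤-refl ; valley≤next = [] }
skeleton a (b ∷ []) u = Skeleton-extend u refl (skeleton b [] (AllPairs.tail u))
skeleton a (b ∷ l@(c ∷ l′)) u with (a <? b) ×-dec (c <? b) | skeleton b l (AllPairs.tail u)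
... | yes (a<b , c<b) | S = Skeleton-extend-peak u a<b c<b S
... | no ¬peak        | S = Skeleton-extend u (Pin-nonpeak l′ ¬peak) S

zigzag-skeleton : ∀ {j Q ω a l} → a ∷ l ↭ [1‥ j ] → (∀ x → x ∈ Pin (a ∷ l) ⇔ x ∈ Q) →
  ord Q (a ∷ l) ≡ ω →
  ∃[ v ] ∃[ vs ] (Zigzag v vs ω × Unique (v ∷ vs) × All (λ x → x ∈ [1‥ j ] × x ∉ Q) (v ∷ vs))
zigzag-skeleton {a = a} {l} π↭ pins ord≡ =
  S.valley , S.valleys , subst (Zigzag S.valley S.valleys) Pin≡ω S.zigzag , S.unique ,
  All.zipWith (λ (x∈π , x∉Pin) → ∈-resp-↭ π↭ x∈π , x∉Pin ∘ from (pins _))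
              (All.tabulate S.valleys⊆word , S.∉Pin)
  where
  uniq = Unique-resp-↭ (↭-sym π↭) (Unique-[1‥] _)
  module S = Skeleton (skeleton a l uniq)
  Pin≡ω = trans (sym (ord-≡-Pin uniq pins)) ord≡

countLE-mono : ∀ {x y} → x ≤ y → ∀ L → countLE x L ≤ countLE y L
countLE-mono {x} {y} x≤y L =
  Sublistₚ.length-mono-≤
    (Sublistₚ.filter⁺ (_≤? x) (_≤? y) (λ { refl a≤x → ≤-trans a≤x x≤y }) (⊑-refl {x = L}))

countLE-∷-≤ : ∀ {a x} L → a ≤ x → countLE x (a ∷ L) ≡ suc (countLE x L)
countLE-∷-≤ {x = x} L a≤x = cong length (filter-accept (_≤? x) a≤x)

countLE-∷-≰ : ∀ {a x} L → ¬ a ≤ x → countLE x (a ∷ L) ≡ countLE x L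
countLE-∷-≰ {x = x} L a≰x = cong length (filter-reject (_≤? x) a≰x)

countLE-< : ∀ {x y} L → y ∈ L → x < y → countLE x L < countLE y L
countLE-< {x} {y} (a ∷ L) y∈ x<y with a ≤? x | a ≤? y | y∈
... | yes a≤x | yes _   | here refl = contradiction a≤x (<⇒≱ x<y)
... | yes a≤x | yes a≤y | there y∈L rewrite countLE-∷-≤ L a≤x | countLE-∷-≤ L a≤y =
  s≤s (countLE-< L y∈L x<y)
... | yes a≤x | no a≰y  | _         = contradiction (≤-trans a≤x (<⇒≤ x<y)) a≰y
... | no a≰x  | yes a≤y | here refl rewrite countLE-∷-≰ L a≰x | countLE-∷-≤ L a≤y =
  s≤s (countLE-mono (<⇒≤ x<y) L)
... | no a≰x  | yes a≤y | there y∈L rewrite countLE-∷-≰ L a≰x | countLE-∷-≤ L a≤y =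
  m≤n⇒m≤1+n (countLE-< L y∈L x<y)
... | no _    | no a≰y  | here refl = contradiction ≤-refl a≰y
... | no a≰x  | no a≰y  | there y∈L rewrite countLE-∷-≰ L a≰x | countLE-∷-≰ L a≰y =
  countLE-< L y∈L x<y

countLE-reflects-< : ∀ {x y} L → countLE x L < countLE y L → x < y
countLE-reflects-< L lt = ≰⇒> (λ y≤x → <⇒≱ lt (countLE-mono y≤x L))

countLE-injectiveOn : ∀ {x y} L → x ∈ L → y ∈ L → countLE x L ≡ countLE y L → x ≡ y
countLE-injectiveOn {x} {y} L x∈ y∈ eq with <-cmp x y
... | tri< x<y _ _ = contradiction eq (<⇒≢ (countLE-< L y∈ x<y))
... | tri≈ _ x≡y _ = x≡y
... | tri> _ _ y<x = contradiction (sym eq) (<⇒≢ (countLE-< L x∈ y<x))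

ranks-↭ : ∀ L → Unique L → [1‥ length L ] ↭ map (λ x → countLE x L) L
ranks-↭ L u = Unique-⊆-length⇒↭ (Unique-map⁺ (countLE-injectiveOn L) u) ranks⊆
  (≤-reflexive (trans (length-[1‥] (length L)) (sym (length-map _ L))))
  where
  ranks⊆ : map (λ x → countLE x L) L ⊆ [1‥ length L ]
  ranks⊆ r∈ with x , x∈L , refl ← ∈-map⁻ _ r∈ =
    ∈-[1‥]⁺ (filter-some (_≤? x) (Any.map (λ { refl → ≤-refl }) x∈L)) (length-filter (_≤? x) L)

-- Enumerating admissible orderings

insertions : ∀ {A : Set} → A → List A → List (List A)
insertions x []       = (x ∷ []) ∷ []
insertions x (y ∷ ys) = (x ∷ y ∷ ys) ∷ map (y ∷_) (insertions x ys)

permutations : ∀ {A : Set} → List A → List (List A)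
permutations []       = [] ∷ []
permutations (x ∷ xs) = concatMap (insertions x) (permutations xs)

∈-insertions⁻ : ∀ {A : Set} {x : A} {zs} ys → zs ∈ insertions x ys → zs ↭ x ∷ ys
∈-insertions⁻ []       (here refl) = ↭-refl
∈-insertions⁻ (y ∷ ys) (here refl) = ↭-refl
∈-insertions⁻ {x = x} (y ∷ ys) (there zs∈) with ws , ws∈ , refl ← ∈-map⁻ (y ∷_) zs∈ =
  ↭-trans (↭-prep y (∈-insertions⁻ ys ws∈)) (↭-swap y x ↭-refl)

∈-insertions⁺ : ∀ {A : Set} (x : A) as bs → as ++ x ∷ bs ∈ insertions x (as ++ bs)
∈-insertions⁺ x []       []       = here refl
∈-insertions⁺ x []       (b ∷ bs) = here refl
∈-insertions⁺ x (a ∷ as) bs       = there (∈-map⁺ (a ∷_) (∈-insertions⁺ x as bs))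

∈-permutations⁻ : ∀ {A : Set} {zs : List A} ys → zs ∈ permutations ys → zs ↭ ys
∈-permutations⁻ []       (here refl) = ↭-refl
∈-permutations⁻ (x ∷ xs) zs∈
  with ws , ws∈ , zs∈′ ← find (∈-concatMap⁻ (insertions x) {xs = permutations xs} zs∈) =
  ↭-trans (∈-insertions⁻ ws zs∈′) (↭-prep x (∈-permutations⁻ xs ws∈))

∈-permutations⁺ : ∀ {A : Set} {zs : List A} ys → zs ↭ ys → zs ∈ permutations ys
∈-permutations⁺ [] zs↭[] rewrite ↭-empty-inv zs↭[] = here refl
∈-permutations⁺ (x ∷ xs) zs↭ with as , bs , refl ← ∈-∃++ (∈-resp-↭ (↭-sym zs↭) (here refl)) =
  ∈-concatMap⁺ (insertions x) {xs = permutations xs}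
    (lose (∈-permutations⁺ xs (drop-mid as [] zs↭)) (∈-insertions⁺ x as bs))

_≟ₗ_ : (xs ys : List ℕ) → Dec (xs ≡ ys)
_≟ₗ_ = ≡-dec ℕ._≟_

PinsAre? : ∀ P π → Dec (∀ x → x ∈ Pin π ⇔ x ∈ P)
PinsAre? P π = map′ (λ (⊆P , P⊆) x → mk⇔ (All.lookup ⊆P) (All.lookup P⊆))
                    (λ pins → All.tabulate (to (pins _)) , All.tabulate (from (pins _)))
                    (All.all? (_∈? P) (Pin π) ×-dec All.all? (_∈? Pin π) P)

-- Admissible n P ω unfolds to (ω ↭ P) × Realised n P ω.
Realised : ℕ → List ℕ → List ℕ → Set
Realised n P ω = ∃[ π ] ((π ↭ [1‥ n ]) × (∀ x → x ∈ Pin π ⇔ x ∈ P) × (ord P π ≡ ω))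

Realised? : ∀ n P ω → Dec (Realised n P ω)
Realised? n P ω =
  map′ (λ any → let π , π∈ , realises = find any in π , ∈-permutations⁻ [1‥ n ] π∈ , realises)
       (λ (π , π↭ , pins , ord≡) → lose (∈-permutations⁺ [1‥ n ] π↭) (pins , ord≡))
       (Any.any? (λ π → PinsAre? P π ×-dec (ord P π ≟ₗ ω)) (permutations [1‥ n ]))

admissibleOrderings : ℕ → List ℕ → List (List ℕ)
admissibleOrderings n P = deduplicate _≟ₗ_ (filter (Realised? n P) (permutations P))

∈-admissibleOrderings : ∀ n P ω → ω ∈ admissibleOrderings n P ⇔ Admissible n P ω
∈-admissibleOrderings n P ω = mk⇔
  (λ ω∈ → let ω∈perms , realised = ∈-filter⁻ (Realised? n P) (∈-deduplicate⁻ _≟ₗ_ _ ω∈)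
          in ∈-permutations⁻ P ω∈perms , realised)
  (λ (ω↭P , realised) →
     ∈-deduplicate⁺ _≟ₗ_ (∈-filter⁺ (Realised? n P) (∈-permutations⁺ P ω↭P) realised))

NumAdmissible-admissibleOrderings : ∀ n P → NumAdmissible n P (length (admissibleOrderings n P))
NumAdmissible-admissibleOrderings n P =
  admissibleOrderings n P , UniqueDecₚ.deduplicate-! _≟ₗ_ _ , ∈-admissibleOrderings n P , refl

NumAdmissible-image : ∀ {n m P Q c} (h : List ℕ → List ℕ) →
  (∀ {ω ω′} → Admissible n P ω → Admissible n P ω′ → h ω ≡ h ω′ → ω ≡ ω′) →
  (∀ ω′ → Admissible m Q ω′ ⇔ (∃[ ω ] (Admissible n P ω × h ω ≡ ω′))) →
  NumAdmissible n P c → NumAdmissible m Q c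
NumAdmissible-image h inj image (L , u , L⇔ , len) =
  map h L , Unique-map⁺ (λ ω∈ ω′∈ → inj (to (L⇔ _) ω∈) (to (L⇔ _) ω′∈)) u , image⇔ ,
  trans (length-map h L) len
  where
  image⇔ : ∀ ω′ → ω′ ∈ map h L ⇔ _
  image⇔ ω′ = mk⇔
    (λ ω′∈ → let ω , ω∈ , ω′≡ = ∈-map⁻ h ω′∈ in from (image ω′) (ω , to (L⇔ ω) ω∈ , sym ω′≡))
    (λ adm → let ω , admω , hω≡ = to (image ω′) adm in
             subst (_∈ map h L) hω≡ (∈-map⁺ h (from (L⇔ ω) admω)))

-- Without pinnacles the transfer below breaks down for n = 0 (S₀ has no room for the
-- valley 1), so this case is counted directly.
NumAdmissible-[] : ∀ n → NumAdmissible n [] 1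
NumAdmissible-[] n = ([] ∷ []) , ([] ∷ []) , only[] , refl
  where
  only[] : ∀ ω → ω ∈ [] ∷ [] ⇔ Admissible n [] ω
  only[] ω = mk⇔
    (λ { (here refl) → ↭-refl , [1‥ n ] , ↭-refl , no-pins ,
                       filter-none (_∈? []) {[1‥ n ]} (All.tabulate λ _ ()) })
    (λ (ω↭[] , _) → here (↭-empty-inv ω↭[]))
    where
    no-pins : ∀ x → x ∈ Pin [1‥ n ] ⇔ x ∈ []
    no-pins x rewrite Pin-increasing ([1‥]-increasing n) = mk⇔ id id

module Standardization (P : List ℕ) (P-increasing : AllPairs _<_ P) where

  k m : ℕ
  k = length P
  m = suc (k + k)

  Available : ℕ → Set
  Available x = 1 ≤ x × x ∉ P

  candidates N L : List ℕ
  candidates = filter (_∉? P) [1‥ m ]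
  N = Nset P
  L = P ++ N

  rank : ℕ → ℕ
  rank x = countLE x L

  ∈-N⁻ : ∀ {x} → x ∈ N → x ∈ [1‥ m ] × x ∉ P
  ∈-N⁻ = ∈-filter⁻ (_∉? P) ∘ lookup (Sublistₚ.take-⊆ (suc k) candidates)

  Available-N : ∀ {x} → x ∈ N → Available x
  Available-N x∈N = let x∈[1‥m] , x∉P = ∈-N⁻ x∈N in proj₁ (∈-[1‥]⁻ x∈[1‥m]) , x∉P

  Unique-N : Unique N
  Unique-N = Uniqueₚ.take⁺ (suc k) (Uniqueₚ.filter⁺ (_∉? P) (Unique-[1‥] m))

  -- [1‥ m] ⊆ P ++ candidates bounds m = 2k + 1 by k + length candidates.
  length-N : length N ≡ suc k
  length-N = trans (length-take (suc k) candidates) (m≤n⇒m⊓n≡m (+-cancelˡ-≤ k (suc k) _ bound))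
    where
    [1‥m]⊆ : [1‥ m ] ⊆ P ++ candidates
    [1‥m]⊆ {x} x∈ with x ∈? P
    ... | yes x∈P = ∈-++⁺ˡ x∈P
    ... | no  x∉P = ∈-++⁺ʳ P (∈-filter⁺ (_∉? P) x∈ x∉P)
    bound : k + suc k ≤ k + length candidates
    bound = begin
      k + suc k                 ≡⟨ sym (trans (length-[1‥] m) (sym (+-suc k k))) ⟩
      length [1‥ m ]            ≤⟨ Unique-⊆⇒length≤ (Unique-[1‥] m) [1‥m]⊆ ⟩
      length (P ++ candidates)  ≡⟨ length-++ P ⟩
      k + length candidates     ∎
      where open ≤-Reasoning

  N-initial : ∀ {u a} → Available u → u ∉ N → a ∈ N → a < u
  N-initial {u} (1≤u , u∉P) u∉N a∈N with u ≤? m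
  ... | yes u≤m = take-< (suc k) (AllPairsₚ.filter⁺ (_∉? P) ([1‥]-increasing m)) a∈N
                    (∈-filter⁺ (_∉? P) (∈-[1‥]⁺ 1≤u u≤m) u∉P) u∉N
  ... | no  u≰m = <-≤-trans (s≤s (proj₂ (∈-[1‥]⁻ (proj₁ (∈-N⁻ a∈N))))) (≰⇒> u≰m)

  Unique-L : Unique L
  Unique-L = Uniqueₚ.++⁺ (AllPairs.map <⇒≢ P-increasing) Unique-N
                         (λ (x∈P , x∈N) → proj₂ (∈-N⁻ x∈N) x∈P)

  length-L : length L ≡ m
  length-L = trans (length-++ P) (trans (cong (k +_) length-N) (+-suc k k))

  [1‥m]↭ranks : [1‥ m ] ↭ map rank L
  [1‥m]↭ranks = subst (λ j → [1‥ j ] ↭ map rank L) length-L (ranks-↭ L Unique-L)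

  rank-injectiveOn : ∀ {x y} → x ∈ L → y ∈ L → rank x ≡ rank y → x ≡ y
  rank-injectiveOn = countLE-injectiveOn L

  ∈-rank⁻ : ∀ {y} → y ∈ [1‥ m ] → ∃[ x ] (x ∈ L × y ≡ rank x)
  ∈-rank⁻ y∈ = ∈-map⁻ rank (∈-resp-↭ [1‥m]↭ranks y∈)

  ∈-P-rank⁻ : ∀ {x} → x ∈ L → rank x ∈ map rank P → x ∈ P
  ∈-P-rank⁻ x∈L rx∈ with p , p∈P , rx≡rp ← ∈-map⁻ rank rx∈ =
    subst (_∈ P) (sym (rank-injectiveOn x∈L (∈-++⁺ˡ p∈P) rx≡rp)) p∈P

  outside : List ℕ → ℕ
  outside vs = length (filter (_∉? N) vs)

  outside-++ : ∀ as bs → outside (as ++ bs) ≡ outside as + outside bs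
  outside-++ as bs = trans (cong length (filter-++ (_∉? N) as bs)) (length-++ (filter (_∉? N) as))

  outside-replace : ∀ as bs {u a} → u ∉ N → a ∈ N →
    outside (as ++ u ∷ bs) ≡ suc (outside (as ++ a ∷ bs))
  outside-replace as bs {u} {a} u∉N a∈N = begin
    outside (as ++ u ∷ bs)              ≡⟨ outside-++ as (u ∷ bs) ⟩
    outside as + outside (u ∷ bs)       ≡⟨ cong (λ j → outside as + length j) u-counted ⟩
    outside as + suc (outside bs)       ≡⟨ +-suc (outside as) (outside bs) ⟩
    suc (outside as + outside bs)       ≡⟨ cong (λ j → suc (outside as + length j)) a-skipped ⟨
    suc (outside as + outside (a ∷ bs)) ≡⟨ cong suc (outside-++ as (a ∷ bs)) ⟨
    suc (outside (as ++ a ∷ bs))        ∎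
    where
    open ≡-Reasoning
    u-counted = filter-accept (_∉? N) u∉N
    a-skipped = filter-reject (_∉? N) (λ a∉N → a∉N a∈N)

  missing-below : ∀ {vs u} → Unique vs → All Available vs → length vs ≡ suc k → u ∈ vs → u ∉ N →
    ∃[ a ] (a ∈ N × a ∉ vs × a < u)
  missing-below {vs} uniq avail len u∈vs u∉N with All.all? (_∈? vs) N
  ... | yes N⊆vs = contradiction
        (∈-resp-↭ (Unique-⊆-length⇒↭ Unique-N (All.lookup N⊆vs) (≤-reflexive (trans len (sym length-N))))
                  u∈vs)
        u∉N
  ... | no N⊈vs with a , a∈N , a∉vs ← find (All.¬All⇒Any¬ (_∈? vs) N N⊈vs) =
        a , a∈N , a∉vs , N-initial (All.lookup avail u∈vs) u∉N a∈N

  exchange-step : ∀ {vs} → Unique vs → All Available vs → length vs ≡ suc k → ¬ All (_∈ N) vs →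
    ∃[ vs′ ] (Pointwise _≤_ vs′ vs × Unique vs′ × All Available vs′ × outside vs′ < outside vs)
  exchange-step {vs} uniq avail len vs⊈N
    with u , u∈vs , u∉N ← find (All.¬All⇒Any¬ (_∈? N) vs vs⊈N)
    with a , a∈N , a∉vs , a<u ← missing-below uniq avail len u∈vs u∉N
    with as , bs , refl ← ∈-∃++ u∈vs
    = as ++ a ∷ bs
    , Pointwise.++⁺ (Pointwise.refl ≤-refl) (<⇒≤ a<u ∷ Pointwise.refl ≤-refl)
    , Unique-replace as bs uniq a∉vs
    , All.++⁺ (All.++⁻ˡ as avail) (Available-N a∈N ∷ All.tail (All.++⁻ʳ as avail))
    , ≤-reflexive (sym (outside-replace as bs u∉N a∈N))

  lower-into-N : ∀ {vs} → Unique vs → All Available vs → length vs ≡ suc k →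
    ∃[ ws ] (Pointwise _≤_ ws vs × ws ↭ N)
  lower-into-N = go (<-wellFounded _)
    where
    go : ∀ {vs} → Acc _<_ (outside vs) → Unique vs → All Available vs → length vs ≡ suc k →
      ∃[ ws ] (Pointwise _≤_ ws vs × ws ↭ N)
    go {vs} (acc smaller) uniq avail len with All.all? (_∈? N) vs
    ... | yes vs⊆N = vs , Pointwise.refl ≤-refl
                   , ↭-sym (Unique-⊆-length⇒↭ uniq (All.lookup vs⊆N)
                                              (≤-reflexive (trans length-N (sym len))))
    ... | no  vs⊈N
      with vs′ , vs′≤vs , uniq′ , avail′ , fewer ← exchange-step uniq avail len vs⊈N
      with ws , ws≤vs′ , ws↭N ← go (smaller fewer) uniq′ avail′
                                  (trans (Pointwise.Pointwise-length vs′≤vs) len)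
      = ws , Pointwise.transitive ≤-trans ws≤vs′ vs′≤vs , ws↭N

  P′ : List ℕ
  P′ = map rank P

  rank-N∉P′ : ∀ {x} → x ∈ N → rank x ∉ P′
  rank-N∉P′ x∈N rx∈P′ = proj₂ (∈-N⁻ x∈N) (∈-P-rank⁻ (∈-++⁺ʳ P x∈N) rx∈P′)

  P′⊆[1‥m] : P′ ⊆ [1‥ m ]
  P′⊆[1‥m] = ∈-resp-↭ (↭-sym [1‥m]↭ranks) ∘ Subsetₚ.map⁺ rank (Subsetₚ.xs⊆xs++ys P N)

  map-rank⁻ : ∀ {ys} → ys ⊆ [1‥ m ] → ∃[ xs ] (xs ⊆ L × map rank xs ≡ ys)
  map-rank⁻ {[]}     _    = [] , (λ ()) , refl
  map-rank⁻ {y ∷ ys} ys⊆ with x , x∈L , y≡ ← ∈-rank⁻ (ys⊆ (here refl)) | map-rank⁻ (ys⊆ ∘ there)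
  ... | xs , xs⊆L , xs≡ = x ∷ xs , ∈-∷⁺ʳ x∈L xs⊆L , cong₂ _∷_ (sym y≡) xs≡

  realise-standardized : ∀ {v vs ω} → Zigzag v vs ω → v ∷ vs ↭ N → ω ↭ P →
    Realised m P′ (map rank ω)
  realise-standardized {v} {vs} {ω} zig V↭N ω↭P = σ , σ↭ , pins , ord≡
    where
    zig′ = Zigzag-map rank (countLE-< L) (∈-++⁺ˡ ∘ ∈-resp-↭ ω↭P) zig
    σ = rank v ∷ weave (map rank vs) (map rank ω) []
    rω↭P′ = ↭-map⁺ rank ω↭P
    pins : ∀ x → x ∈ Pin σ ⇔ x ∈ P′
    pins x rewrite Pin-weave zig′ [] [] = mk⇔ (∈-resp-↭ rω↭P′) (∈-resp-↭ (↭-sym rω↭P′))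
    ord≡ : ord P′ σ ≡ map rank ω
    ord≡ = ord-weave zig′ (All.map⁺ (All.tabulate (rank-N∉P′ ∘ ∈-resp-↭ V↭N)))
                          (All.map⁺ (All.tabulate (∈-map⁺ rank ∘ ∈-resp-↭ ω↭P))) []
    σ↭ : σ ↭ [1‥ m ]
    σ↭ = begin
      σ                                     ↭⟨ ↭-prep (rank v) (weave-↭ [] zig′) ⟩
      map rank (v ∷ vs) ++ map rank ω ++ [] ↭⟨ ↭-++⁺ (↭-map⁺ rank V↭N) (↭-trans (++-identityʳ _) rω↭P′) ⟩
      map rank N ++ P′                      ↭⟨ ↭-++-comm (map rank N) P′ ⟩
      P′ ++ map rank N                      ≡⟨ map-++ rank P N ⟨
      map rank L                            ↭⟨ [1‥m]↭ranks ⟨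
      [1‥ m ]                               ∎
      where open PermutationReasoning

  lower-zigzag : ∀ {v vs ω} → Zigzag v vs ω → Unique (v ∷ vs) → All Available (v ∷ vs) → ω ↭ P →
    ∃[ w ] ∃[ ws ] (Zigzag w ws ω × w ∷ ws ↭ N)
  lower-zigzag zig uniq avail ω↭P
    with w ∷ ws , W≤V , W↭N ← lower-into-N uniq avail
                                (cong suc (trans (Zigzag-length zig) (↭-length ω↭P)))
    = w , ws , Zigzag-lower W≤V zig , W↭N

  unrank-zigzag : ∀ {v′ vs′ ω′} → Zigzag v′ vs′ ω′ → Unique (v′ ∷ vs′) →
    All (λ x → x ∈ [1‥ m ] × x ∉ P′) (v′ ∷ vs′) → ω′ ↭ P′ →
    ∃[ v ] ∃[ vs ] ∃[ ω ] (Zigzag v vs ω × v ∷ vs ↭ N × ω ↭ P × map rank ω ≡ ω′)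
  unrank-zigzag {ω′ = ω′} zig uniq valleys ω′↭P′
    with v ∷ vs , V⊆L , refl ← map-rank⁻ (proj₁ ∘ All.lookup valleys)
    with ω , ω⊆L , refl ← map-rank⁻ (P′⊆[1‥m] ∘ ∈-resp-↭ ω′↭P′)
    = v , vs , ω , zig₀ , V↭N , ω↭P , refl
    where
    zig₀ = Zigzag-unmap vs ω rank (countLE-reflects-< L) zig
    ω⊆P : ω ⊆ P
    ω⊆P x∈ω = ∈-P-rank⁻ (ω⊆L x∈ω) (∈-resp-↭ ω′↭P′ (∈-map⁺ rank x∈ω))
    V⊆N : v ∷ vs ⊆ N
    V⊆N {x} x∈V with ∈-++⁻ P (V⊆L x∈V)
    ... | inj₁ x∈P = contradiction (∈-map⁺ rank x∈P) (proj₂ (All.lookup valleys (∈-map⁺ rank x∈V)))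
    ... | inj₂ x∈N = x∈N
    Unique-ω : Unique ω
    Unique-ω = Uniqueₚ.map⁻ (Unique-resp-↭ (↭-sym ω′↭P′)
                 (Unique-map⁺ (λ x∈ y∈ → rank-injectiveOn (∈-++⁺ˡ x∈) (∈-++⁺ˡ y∈))
                              (AllPairs.map <⇒≢ P-increasing)))
    length-ω : length ω ≡ k
    length-ω = trans (sym (length-map rank ω)) (trans (↭-length ω′↭P′) (length-map rank P))
    ω↭P = ↭-sym (Unique-⊆-length⇒↭ Unique-ω ω⊆P (≤-reflexive (sym length-ω)))
    V↭N = ↭-sym (Unique-⊆-length⇒↭ (Uniqueₚ.map⁻ uniq) V⊆N
            (≤-reflexive (trans length-N (cong suc (sym (trans (Zigzag-length zig₀) length-ω))))))

-- A pinnacle p₀ makes every realising word non-empty and bounds the valleys by n.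
module Transfer (n : ℕ) (P : List ℕ) (P⊆[n] : IsSubsetOf[n] n P) {p₀ : ℕ} (p₀∈P : p₀ ∈ P) where

  open Standardization P (proj₁ P⊆[n])

  P⊆[1‥n] : P ⊆ [1‥ n ]
  P⊆[1‥n] p∈P = let 1≤p , p≤n = All.lookup (proj₂ P⊆[n]) p∈P in ∈-[1‥]⁺ 1≤p p≤n

  realise : ∀ {v vs ω} → Zigzag v vs ω → v ∷ vs ↭ N → ω ↭ P → Realised n P ω
  realise {v} {vs} {ω} zig V↭N ω↭P = π , π↭ , pins , ord≡
    where
    t = filter (_∉? L) [1‥ n ]
    π = v ∷ weave vs ω t
    t⁻ : ∀ {r} → r ∈ t → r ∈ [1‥ n ] × r ∉ L
    t⁻ = ∈-filter⁻ (_∉? L)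
    N⊆[1‥n] : N ⊆ [1‥ n ]
    N⊆[1‥n] x∈N = ∈-[1‥]⁺ (proj₁ (Available-N x∈N)) (All.lookup V≤n (∈-resp-↭ (↭-sym V↭N) x∈N))
      where
      V≤n = Zigzag-bounded zig (All.tabulate (proj₂ ∘ ∈-[1‥]⁻ ∘ P⊆[1‥n] ∘ ∈-resp-↭ ω↭P))
                           (∈-resp-↭ (↭-sym ω↭P) p₀∈P)
    t-above : All (λ r → All (_< r) (v ∷ vs)) t
    t-above = All.tabulate λ r∈t → let r∈[1‥n] , r∉L = t⁻ r∈t in All.tabulate λ x∈V →
      N-initial (proj₁ (∈-[1‥]⁻ r∈[1‥n]) , r∉L ∘ ∈-++⁺ˡ) (r∉L ∘ ∈-++⁺ʳ P) (∈-resp-↭ V↭N x∈V)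
    pins : ∀ x → x ∈ Pin π ⇔ x ∈ P
    pins x rewrite Pin-weave zig (AllPairsₚ.filter⁺ (_∉? L) ([1‥]-increasing n)) t-above =
      mk⇔ (∈-resp-↭ ω↭P) (∈-resp-↭ (↭-sym ω↭P))
    ord≡ : ord P π ≡ ω
    ord≡ = ord-weave zig (All.tabulate (proj₂ ∘ Available-N ∘ ∈-resp-↭ V↭N))
                         (All.tabulate (∈-resp-↭ ω↭P))
                         (All.tabulate λ r∈t → proj₂ (t⁻ r∈t) ∘ ∈-++⁺ˡ)
    L++t⊆[1‥n] : L ++ t ⊆ [1‥ n ]
    L++t⊆[1‥n] x∈ with ∈-++⁻ L x∈
    ... | inj₂ x∈t = proj₁ (t⁻ x∈t)
    ... | inj₁ x∈L with ∈-++⁻ P x∈L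
    ...   | inj₁ x∈P = P⊆[1‥n] x∈P
    ...   | inj₂ x∈N = N⊆[1‥n] x∈N
    [1‥n]⊆L++t : [1‥ n ] ⊆ L ++ t
    [1‥n]⊆L++t {x} x∈ with x ∈? L
    ... | yes x∈L = ∈-++⁺ˡ x∈L
    ... | no  x∉L = ∈-++⁺ʳ L (∈-filter⁺ (_∉? L) x∈ x∉L)
    Unique-L++t : Unique (L ++ t)
    Unique-L++t = Uniqueₚ.++⁺ Unique-L (Uniqueₚ.filter⁺ (_∉? L) (Unique-[1‥] n))
                              (λ (x∈L , x∈t) → proj₂ (t⁻ x∈t) x∈L)
    π↭ : π ↭ [1‥ n ]
    π↭ = begin
      π                    ↭⟨ ↭-prep v (weave-↭ t zig) ⟩
      (v ∷ vs) ++ ω ++ t   ↭⟨ ↭-++⁺ V↭N (↭-++⁺ʳ t ω↭P) ⟩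
      N ++ P ++ t          ↭⟨ shifts N P ⟩
      P ++ N ++ t          ≡⟨ ++-assoc P N t ⟨
      L ++ t               ↭⟨ Unique-⊆-length⇒↭ Unique-L++t L++t⊆[1‥n]
                                (Unique-⊆⇒length≤ (Unique-[1‥] n) [1‥n]⊆L++t) ⟨
      [1‥ n ]              ∎
      where open PermutationReasoning

  standardize-admissible : ∀ {ω} → Admissible n P ω → Admissible m P′ (map rank ω)
  standardize-admissible (_ , [] , _ , pins , _) = contradiction (from (pins p₀) p₀∈P) λ ()
  standardize-admissible (ω↭P , a ∷ l , π↭ , pins , ord≡)
    with v , vs , zig , uniq , valleys ← zigzag-skeleton π↭ pins ord≡
    with w , ws , zig′ , W↭N ← lower-zigzag zig uniq
                                 (All.map (λ (x∈ , x∉P) → proj₁ (∈-[1‥]⁻ x∈) , x∉P) valleys) ω↭P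
    = ↭-map⁺ rank ω↭P , realise-standardized zig′ W↭N ω↭P

  unstandardize-admissible : ∀ {ω′} → Admissible m P′ ω′ →
    ∃[ ω ] (Admissible n P ω × map rank ω ≡ ω′)
  unstandardize-admissible (_ , [] , σ↭ , _) = contradiction (↭-length σ↭) λ ()
  unstandardize-admissible (ω′↭P′ , a ∷ l , σ↭ , pins , ord≡)
    with v′ , vs′ , zig′ , uniq , valleys ← zigzag-skeleton σ↭ pins ord≡
    with v , vs , ω , zig , V↭N , ω↭P , refl ← unrank-zigzag zig′ uniq valleys ω′↭P′
    = ω , (ω↭P , realise zig V↭N ω↭P) , refl

  rank-admissible-injective : ∀ {ω ω′} → Admissible n P ω → Admissible n P ω′ →
    map rank ω ≡ map rank ω′ → ω ≡ ω′
  rank-admissible-injective (ω↭P , _) (ω′↭P , _) =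
    map-injectiveOn rank-injectiveOn (∈-++⁺ˡ ∘ ∈-resp-↭ ω↭P) (∈-++⁺ˡ ∘ ∈-resp-↭ ω′↭P)

  NumAdmissible-standardize : ∀ {c} → NumAdmissible n P c → NumAdmissible m P′ c
  NumAdmissible-standardize = NumAdmissible-image (map rank) rank-admissible-injective
    λ ω′ → mk⇔ unstandardize-admissible
                λ (ω , adm , rω≡ω′) → subst (Admissible m P′) rω≡ω′ (standardize-admissible adm)

mainTheorem4 : (n : ℕ) (P : List ℕ) → IsSubsetOf[n] n P →
    ∃[ c ] (NumAdmissible n P c ×
            NumAdmissible (suc (length P + length P)) (standardize P) c)
mainTheorem4 n []      _       = 1 , NumAdmissible-[] n , NumAdmissible-[] 1
mainTheorem4 n (p ∷ P) p∷P⊆[n] =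
  _ , counted , Transfer.NumAdmissible-standardize n (p ∷ P) p∷P⊆[n] (here refl) counted
  where counted = NumAdmissible-admissibleOrderings n (p ∷ P)
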